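{- Let $G=(V,E)$ be the bipartite graph with vertex set $V=\{v_1,\dots,v_{10}\}$ (sides $\{v_1,\dots,v_5\}$ and $\{v_6,\dots,v_{10}\}$) and edge set $E=\{\{v_1,v_6\},\{v_1,v_7\},\{v_2,v_6\},\{v_2,v_7\},\{v_2,v_8\},\{v_3,v_7\},\{v_3,v_9\},\{v_3,v_{10}\},\{v_4,v_8\},\{v_4,v_9\},\{v_4,v_{10}\},\{v_5,v_8\},\{v_5,v_9\},\{v_5,v_{10}\}\}$, with red edges $R=\{\{v_2,v_7\},\{v_4,v_9\},\{v_5,v_{10}\}\}$. Let $y\in\mathbb{R}^E$ with $y_{\{v_1,v_6\}}=\frac23$ and $y_e=\frac13$ for all other $e\in E$. Then $y\in Q_{(G,R)}$.
   Context: Here each side has $n=5$ vertices. $\mathcal{L}_{\mathrm{all}}(G):=\{L\colon V\to\{0,1\}\text{ with }|L^{ -1}(1)|\equiv n\pmod 2\}$; for $L\in\mathcal{L}_{\mathrm{all}}(G)$, $E_L:=\{\{u,v\}\in E\setminus R\colon L(u)=L(v)\}\cup\{\{u,v\}\in R\colon L(u)\neq L(v)\}$. The label constraint relaxation is $Q_{(G,R)}:=\{x\in\mathbb{R}^E_{\geq 0}\colon x(\delta(u))=1\ \forall u\in V,\ x(E_L)\geq 1\ \forall L\in\mathcal{L}_{\mathrm{all}}(G)\}$, where $\delta(u)$ is the set of edges at $u$ and $x(S)=\sum_{e\in S}x_e$. -}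

module Defs where

open import Data.Nat using (ℕ; zero; suc; _%_)
open import Data.Bool using (Bool; true; false; if_then_else_; _∨_; not)
open import Data.Fin using (Fin; zero; suc)
open import Data.Fin.Properties using (_≟_)
open import Data.Product using (_×_; _,_; proj₁; proj₂)
open import Data.Integer using (+_)
open import Data.Rational using (ℚ; 0ℚ; 1ℚ; _+_; _≤_; _/_)
open import Relation.Nullary.Decidable using (⌊_⌋)
open import Relation.Binary.PropositionalEquality using (_≡_)

sumFin : (m : ℕ) → (Fin m → ℚ) → ℚ
sumFin zero    f = 0ℚ
sumFin (suc m) f = f zero + sumFin m (λ i → f (suc i))

countTrue : (k : ℕ) → (Fin k → Bool) → ℕ
countTrue zero    L = zero
countTrue (suc k) L = (if L zero then 1 else 0) Data.Nat.+ countTrue k (λ i → L (suc i))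

record RedGraph : Set where
  field
    nV   : ℕ
    m    : ℕ
    ends : Fin m → Fin nV × Fin nV
    red  : Fin m → Bool
open RedGraph public

xOf : (G : RedGraph) → (Fin (m G) → ℚ) → (Fin (m G) → Bool) → ℚ
xOf G x S = sumFin (m G) (λ e → if S e then x e else 0ℚ)

δ : (G : RedGraph) → Fin (nV G) → Fin (m G) → Bool
δ G u e = ⌊ proj₁ (ends G e) ≟ u ⌋ ∨ ⌊ proj₂ (ends G e) ≟ u ⌋

E_ : (G : RedGraph) → (Fin (nV G) → Bool) → Fin (m G) → Bool
E_ G L e with ends G e
... | (u , v) = if red G e then not (eqB (L u) (L v)) else eqB (L u) (L v)
  where
  eqB : Bool → Bool → Bool
  eqB true  b = b
  eqB false b = not b

-- L ∈ L_all(G): |L⁻¹(1)| ≡ n (mod 2), n = number of vertices on each side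
-- (label 1 is represented by true).
InLall : (G : RedGraph) → (n : ℕ) → (Fin (nV G) → Bool) → Set
InLall G n L = countTrue (nV G) L % 2 ≡ n % 2

InQ : (G : RedGraph) → (n : ℕ) → (Fin (m G) → ℚ) → Set
InQ G n x =
  ((e : Fin (m G)) → 0ℚ ≤ x e) ×
  ((u : Fin (nV G)) → xOf G x (δ G u) ≡ 1ℚ) ×
  ((L : Fin (nV G) → Bool) → InLall G n L → 1ℚ ≤ xOf G x (E_ G L))

-- The concrete instance. Vertex v_i is (i-1) : Fin 10.

v : (i : ℕ) → Fin 10
v 1 = zero
v 2 = suc zero
v 3 = suc (suc zero)
v 4 = suc (suc (suc zero))
v 5 = suc (suc (suc (suc zero)))
v 6 = suc (suc (suc (suc (suc zero))))
v 7 = suc (suc (suc (suc (suc (suc zero)))))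
v 8 = suc (suc (suc (suc (suc (suc (suc zero))))))
v 9 = suc (suc (suc (suc (suc (suc (suc (suc zero)))))))
v _ = suc (suc (suc (suc (suc (suc (suc (suc (suc zero))))))))  -- v 10

-- Edges, in the order listed in the statement:
-- 0:{1,6} 1:{1,7} 2:{2,6} 3:{2,7} 4:{2,8} 5:{3,7} 6:{3,9} 7:{3,10}
-- 8:{4,8} 9:{4,9} 10:{4,10} 11:{5,8} 12:{5,9} 13:{5,10}
endsC : Fin 14 → Fin 10 × Fin 10
endsC zero = v 1 , v 6
endsC (suc zero) = v 1 , v 7
endsC (suc (suc zero)) = v 2 , v 6
endsC (suc (suc (suc zero))) = v 2 , v 7
endsC (suc (suc (suc (suc zero)))) = v 2 , v 8
endsC (suc (suc (suc (suc (suc zero))))) = v 3 , v 7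
endsC (suc (suc (suc (suc (suc (suc zero)))))) = v 3 , v 9
endsC (suc (suc (suc (suc (suc (suc (suc zero))))))) = v 3 , v 10
endsC (suc (suc (suc (suc (suc (suc (suc (suc zero)))))))) = v 4 , v 8
endsC (suc (suc (suc (suc (suc (suc (suc (suc (suc zero))))))))) = v 4 , v 9
endsC (suc (suc (suc (suc (suc (suc (suc (suc (suc (suc zero)))))))))) = v 4 , v 10
endsC (suc (suc (suc (suc (suc (suc (suc (suc (suc (suc (suc zero))))))))))) = v 5 , v 8
endsC (suc (suc (suc (suc (suc (suc (suc (suc (suc (suc (suc (suc zero)))))))))))) = v 5 , v 9
endsC (suc (suc (suc (suc (suc (suc (suc (suc (suc (suc (suc (suc (suc zero))))))))))))) = v 5 , v 10

-- Red edges R = {{2,7},{4,9},{5,10}} = edges 3, 9, 13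
redC : Fin 14 → Bool
redC (suc (suc (suc zero))) = true
redC (suc (suc (suc (suc (suc (suc (suc (suc (suc zero))))))))) = true
redC (suc (suc (suc (suc (suc (suc (suc (suc (suc (suc (suc (suc (suc zero))))))))))))) = true
redC _ = false

Gex : RedGraph
Gex = record { nV = 10 ; m = 14 ; ends = endsC ; red = redC }

y : Fin 14 → ℚ
y zero    = + 2 / 3
y (suc _) = + 1 / 3

{-# OPTIONS --safe #-}
-- Q is cut out by finitely many decidable statements about rationals: one per
-- edge, one per vertex and one per labelling.  A label constraint depends on L
-- only through its values, so checking it on the 2^10 labellings built by _∷_
-- covers every L : Fin 10 → Bool.
module Submission where

open import Defs
open import Data.Nat using (ℕ; zero; suc; _%_)
import Data.Nat as ℕ
open import Data.Bool using (Bool; true; false; if_then_else_)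
open import Data.Fin using (Fin; zero; suc)
open import Data.Fin.Properties using (all?)
open import Data.Product using (_,_)
open import Data.Vec.Functional using (_∷_; head; tail)
open import Data.Rational using (ℚ; 0ℚ; 1ℚ; _≤_)
import Data.Rational as ℚ
open import Data.Rational.Properties using (_≤?_; _≟_)
open import Function using (_∘_)
open import Level using (Level; 0ℓ)
open import Relation.Binary.Definitions using (_Respects_)
open import Relation.Binary.PropositionalEquality
  using (_≡_; _≗_; refl; sym; cong; cong₂; subst)
open import Relation.Nullary.Decidable using (Dec; map′; _×-dec_; _→-dec_; from-yes)
open import Relation.Unary using (Pred; Decidable)

Labelling : ℕ → Set
Labelling n = Fin n → Bool

∷-head-tail : ∀ {n} (L : Labelling (suc n)) → (head L ∷ tail L) ≗ L
∷-head-tail L zero    = refl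
∷-head-tail L (suc i) = refl

∷-congʳ : ∀ {n} (b : Bool) {L L′ : Labelling n} → L ≗ L′ → (b ∷ L) ≗ (b ∷ L′)
∷-congʳ b eq zero    = refl
∷-congʳ b eq (suc i) = eq i

∀-labelling? : ∀ {ℓ : Level} {n} {P : Pred (Labelling n) ℓ} →
               P Respects _≗_ → Decidable P → Dec (∀ L → P L)
∀-labelling? {n = zero} resp P? =
  map′ (λ p L → resp (λ ()) p) (λ h → h noLabels) (P? noLabels)
  where
  noLabels : Labelling zero
  noLabels ()
∀-labelling? {n = suc _} {P} resp P? =
  map′ (λ (Pᵗ , Pᶠ) L → resp (∷-head-tail L) (fixHead (head L) Pᵗ Pᶠ (tail L)))
       (λ h → (λ L → h (true ∷ L)) , (λ L → h (false ∷ L)))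
       (decideWithHead true ×-dec decideWithHead false)
  where
  decideWithHead : (b : Bool) → Dec (∀ L → P (b ∷ L))
  decideWithHead b = ∀-labelling? (resp ∘ ∷-congʳ b) (P? ∘ (b ∷_))

  fixHead : ∀ b → (∀ L → P (true ∷ L)) → (∀ L → P (false ∷ L)) → ∀ L → P (b ∷ L)
  fixHead true  Pᵗ Pᶠ = Pᵗ
  fixHead false Pᵗ Pᶠ = Pᶠ

sumFin-cong : ∀ m {f g : Fin m → ℚ} → f ≗ g → sumFin m f ≡ sumFin m g
sumFin-cong zero    eq = refl
sumFin-cong (suc m) eq = cong₂ ℚ._+_ (eq zero) (sumFin-cong m (eq ∘ suc))

countTrue-cong : ∀ k {L L′ : Labelling k} → L ≗ L′ → countTrue k L ≡ countTrue k L′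
countTrue-cong zero    eq = refl
countTrue-cong (suc k) eq =
  cong₂ ℕ._+_ (cong (λ b → if b then 1 else 0) (eq zero)) (countTrue-cong k (eq ∘ suc))

xOf-cong : ∀ G x {S S′ : Fin (m G) → Bool} → S ≗ S′ → xOf G x S ≡ xOf G x S′
xOf-cong G x eq = sumFin-cong (m G) (λ e → cong (λ b → if b then x e else 0ℚ) (eq e))

E-cong : ∀ G {L L′ : Labelling (nV G)} → L ≗ L′ → E_ G L ≗ E_ G L′
E-cong G eq e with ends G e
... | (u , w) rewrite eq u | eq w = refl

LabelConstraint : (G : RedGraph) → ℕ → (Fin (m G) → ℚ) → Pred (Labelling (nV G)) 0ℓ
LabelConstraint G n x L = InLall G n L → 1ℚ ≤ xOf G x (E_ G L)

labelConstraint-respects-≗ : ∀ G n x → LabelConstraint G n x Respects _≗_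
labelConstraint-respects-≗ G n x eq holds inLall =
  subst (1ℚ ≤_) (xOf-cong G x (E-cong G eq))
        (holds (subst (λ c → c % 2 ≡ n % 2) (sym (countTrue-cong (nV G) eq)) inLall))

labelConstraint? : ∀ G n x → Decidable (LabelConstraint G n x)
labelConstraint? G n x L = (countTrue (nV G) L % 2 ℕ.≟ n % 2) →-dec (1ℚ ≤? xOf G x (E_ G L))

lemmaC2 : InQ Gex 5 y
lemmaC2 =
  from-yes (all? λ e → 0ℚ ≤? y e) ,
  from-yes (all? λ u → xOf Gex y (δ Gex u) ≟ 1ℚ) ,
  from-yes (∀-labelling? (labelConstraint-respects-≗ Gex 5 y) (labelConstraint? Gex 5 y))
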